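{- Let $P=f_1,\dots,f_b$ be a valid PBP of $T$ and let $i=|f_1\cdots f_b|+1$. Then for any $j>i$ and $\ell\ge1$ with $j+\ell-1\le n$ and $T[i..i+\ell-1]=T[j..j+\ell-1]$, the PBP $P\cdot\langle j,\ell\rangle$ is also valid.
   Context: Let $T=T[1]\cdots T[n]$ be a string over an ordered alphabet $\Sigma$ (elements regarded as distinct from integers); $T[a..b]$ denotes a substring. A partial bidirectional parse (PBP) of $T$ is a sequence of phrases $f_1,\dots,f_k$ partitioning a prefix $T[1..m]$, with $f_x=T[s_x..s_x+|f_x|-1]$, $s_1=1$, $s_{x+1}=s_x+|f_x|$; each phrase is a character phrase ($|f_x|=1$, storing $T[s_x]$) or a target phrase $\langle t_x,|f_x|\rangle$ with $t_x\in\{1,\dots,n\}$, $t_x\ne s_x$, $t_x+|f_x|-1\le n$, $T[t_x..t_x+|f_x|-1]=T[s_x..s_x+|f_x|-1]$ (overlaps allowed). $B_P$ is $P$ followed by the character phrases $T[m+1],\dots,T[n]$. For $B_P$ define $g^0(x)=T[x]$ if $x$ lies in a character phrase and $g^0(x)=t_p+(x-s_p)$ if $x$ lies in target phrase $f_p$; $g^k(x)=g^{k-1}(x)$ if $g^{k-1}(x)\in\Sigma$, else $g^k(x)=g^0(g^{k-1}(x))$. $P$ is valid if $g^n(x)\in\Sigma$ for all $x\in\{1,\dots,n\}$. $P\cdot\langle j,\ell\rangle$ appends the target phrase $\langle j,\ell\rangle$ covering $T[i..i+\ell-1]$. -}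

module Defs where

open import Data.Nat using (ℕ; zero; suc; _+_; _∸_; _≤_; _<_; _<?_)
open import Data.Nat.Properties using ()
open import Data.Fin using (Fin; fromℕ<)
open import Data.List using (List; []; _∷_)
open import Data.Maybe using (Maybe; just; nothing)
open import Data.Sum using (_⊎_; inj₁; inj₂)
open import Data.Product using (_×_; ∃)
open import Data.Unit using (⊤)
open import Relation.Nullary using (¬_; yes; no)
open import Relation.Binary.PropositionalEquality using (_≡_)

-- A string T = T[1] ⋯ T[n] over alphabet A is a function Fin n → A.
-- Positions are 1-based natural numbers; `at T x` is T[x] when 1 ≤ x ≤ n,
-- and nothing otherwise.
at : {A : Set} {n : ℕ} → (Fin n → A) → ℕ → Maybe A
at T zero = nothing
at {n = n} T (suc x) with x <? n
... | yes p = just (T (fromℕ< p))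
... | no _  = nothing

-- T[a..a+ℓ-1] = T[b..b+ℓ-1]  (both ranges are additionally required to be in bounds
-- by the callers)
SubEq : {A : Set} {n : ℕ} → (Fin n → A) → ℕ → ℕ → ℕ → Set
SubEq T a b ℓ = ∀ k → k < ℓ → at T (a + k) ≡ at T (b + k)

data Phrase (A : Set) : Set where
  chr : A → Phrase A
  tgt : ℕ → ℕ → Phrase A

len : {A : Set} → List (Phrase A) → ℕ
len [] = 0
len (chr _ ∷ P) = suc (len P)
len (tgt _ ℓ ∷ P) = ℓ + len P

PBP-from : {A : Set} {n : ℕ} → (Fin n → A) → ℕ → List (Phrase A) → Set
PBP-from {n = n} T s [] = s ≤ suc n
PBP-from {n = n} T s (chr c ∷ P) = at T s ≡ just c × PBP-from T (suc s) P
PBP-from {n = n} T s (tgt t ℓ ∷ P) =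
  1 ≤ ℓ × 1 ≤ t × ¬ (t ≡ s) × t + ℓ ∸ 1 ≤ n × s + ℓ ∸ 1 ≤ n × SubEq T s t ℓ
  × PBP-from T (s + ℓ) P

IsPBP : {A : Set} {n : ℕ} → (Fin n → A) → List (Phrase A) → Set
IsPBP T P = PBP-from T 1 P

-- g⁰ for B_P : values in Σ are inj₁, positions are inj₂.
-- Positions after the parsed prefix lie in the character phrases T[m+1], …, T[n].
-- (Out-of-range positions get the junk value inj₂ 0; never used for 1 ≤ x ≤ n.)
g0-from : {A : Set} {n : ℕ} → (Fin n → A) → ℕ → List (Phrase A) → ℕ → A ⊎ ℕ
g0-from T s [] x with at T x
... | just a  = inj₁ a
... | nothing = inj₂ 0
g0-from T s (chr c ∷ P) x with x <? suc s
... | yes _ = inj₁ c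
... | no _  = g0-from T (suc s) P x
g0-from T s (tgt t ℓ ∷ P) x with x <? s + ℓ
... | yes _ = inj₂ (t + (x ∸ s))
... | no _  = g0-from T (s + ℓ) P x

g0 : {A : Set} {n : ℕ} → (Fin n → A) → List (Phrase A) → ℕ → A ⊎ ℕ
g0 T P = g0-from T 1 P

g : {A : Set} {n : ℕ} → (Fin n → A) → List (Phrase A) → ℕ → ℕ → A ⊎ ℕ
g T P zero x = g0 T P x
g T P (suc k) x with g T P k x
... | inj₁ a = inj₁ a
... | inj₂ y = g0 T P y

Valid : {A : Set} {n : ℕ} → (Fin n → A) → List (Phrase A) → Set
Valid {A} {n} T P = ∀ x → 1 ≤ x → x ≤ n → ∃ λ (a : A) → g T P n x ≡ inj₁ a

-- Appending ⟨j, ℓ⟩ changes g⁰ only on the new block [i, i + ℓ), where it now points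
-- strictly forward, to j + (x − i) > x; every position ≥ i outside the block is a
-- character. An orbit of the new g⁰ therefore follows the old (terminating) orbit
-- while it stays inside the old prefix, and once it leaves the prefix it increases
-- strictly until it reaches a character. Finally, an orbit that stays in
-- {1, …, n} and terminates at all terminates within n steps, by pigeonhole.
module Submission where

open import Defs
open import Data.Nat using (ℕ; zero; suc; _+_; _∸_; _≤_; _<_; _≤′_; ≤′-refl; ≤′-step; z≤n; s≤s; _<?_)
open import Data.Nat.Properties
open import Data.Nat.Induction using (<-wellFounded)
open import Data.Fin using (Fin; toℕ; fromℕ<)
open import Data.Fin.Properties using (pigeonhole; fromℕ<-injective; toℕ<n)
open import Data.List using (List; []; _∷_; _++_; [_])
open import Data.Empty using (⊥-elim)
open import Data.Sum using (_⊎_; inj₁; inj₂; [_,_]′)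
open import Data.Sum.Properties using (inj₂-injective)
open import Data.Product using (_×_; _,_; ∃; proj₁; proj₂)
open import Function using (id; _on_)
open import Induction.WellFounded using (Acc; acc)
open import Relation.Binary.Construct.On as On using ()
open import Relation.Nullary using (yes; no)
open import Relation.Binary.PropositionalEquality hiding ([_])
open import Relation.Binary.Structures using (IsStrictTotalOrder)

InRange : ℕ → ℕ → Set
InRange n x = 1 ≤ x × x ≤ n

offset< : ∀ {s x} ℓ → s ≤ x → x < s + ℓ → x ∸ s < ℓ
offset< {s} {x} ℓ s≤x x<s+ℓ =
  +-cancelˡ-< s (x ∸ s) ℓ (subst (_< s + ℓ) (sym (m+[n∸m]≡n s≤x)) x<s+ℓ)

block-≤ : ∀ {t ℓ d n} → d < ℓ → t + ℓ ∸ 1 ≤ n → t + d ≤ n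
block-≤ {t} d<ℓ t+ℓ∸1≤n = ≤-trans (<⇒≤pred (+-monoʳ-< t d<ℓ)) t+ℓ∸1≤n

∸1≤⇒≤suc : ∀ {m n} → m ∸ 1 ≤ n → m ≤ suc n
∸1≤⇒≤suc {m} m∸1≤n = ≤-trans (m≤n+m∸n m 1) (s≤s m∸1≤n)

slot : ∀ {n x} → InRange n x → Fin n
slot {x = suc x} (_ , x<n) = fromℕ< x<n

slot-injective : ∀ {n x y} (x∈ : InRange n x) (y∈ : InRange n y) → slot x∈ ≡ slot y∈ → x ≡ y
slot-injective {x = suc x} {suc y} (_ , x<n) (_ , y<n) eq =
  cong suc (fromℕ<-injective x y x<n y<n eq)

module Orbit {A : Set} (F : ℕ → A ⊎ ℕ) where

  step : ℕ → ℕ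
  step x = [ (λ _ → x) , id ]′ (F x)

  step-char : ∀ {x a} → F x ≡ inj₁ a → step x ≡ x
  step-char {x} eq = cong [ (λ _ → x) , id ]′ eq

  step-ptr : ∀ {x y} → F x ≡ inj₂ y → step x ≡ y
  step-ptr {x} eq = cong [ (λ _ → x) , id ]′ eq

  walk : ℕ → ℕ → ℕ
  walk zero x = x
  walk (suc k) x = step (walk k x)

  walk-step : ∀ k x → walk (suc k) x ≡ walk k (step x)
  walk-step zero x = refl
  walk-step (suc k) x = cong step (walk-step k x)

  HaltsIn : ℕ → ℕ → Set
  HaltsIn k x = ∃ λ a → F (walk k x) ≡ inj₁ a

  Halts : ℕ → Set
  Halts x = ∃ λ k → HaltsIn k x

  walk-ptr : ∀ k {x y} → F x ≡ inj₂ y → walk (suc k) x ≡ walk k y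
  walk-ptr k {x} ptr = trans (walk-step k x) (cong (walk k) (step-ptr ptr))

  haltsIn-ptr : ∀ {k x y} → F x ≡ inj₂ y → HaltsIn (suc k) x → HaltsIn k y
  haltsIn-ptr {k} ptr (a , h) = a , trans (cong F (sym (walk-ptr k ptr))) h

  halts-ptr : ∀ {x y} → F x ≡ inj₂ y → Halts y → Halts x
  halts-ptr ptr (k , a , h) = suc k , a , trans (cong F (walk-ptr k ptr)) h

  haltsIn-suc : ∀ {k x} → HaltsIn k x → HaltsIn (suc k) x
  haltsIn-suc (a , h) = a , trans (cong F (step-char h)) h

  haltsIn-mono : ∀ {k m x} → k ≤′ m → HaltsIn k x → HaltsIn m x
  haltsIn-mono ≤′-refl h = h
  haltsIn-mono {k} {suc m} {x} (≤′-step k≤m) h = haltsIn-suc {m} (haltsIn-mono {k} {m} {x} k≤m h)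

  Closed : ℕ → Set
  Closed n = ∀ x y → InRange n x → F x ≡ inj₂ y → InRange n y

  step-in : ∀ {n} → Closed n → ∀ {x} → InRange n x → InRange n (step x)
  step-in closed {x} x∈ with F x in eq
  ... | inj₁ _ = x∈
  ... | inj₂ y = closed x y x∈ eq

  walk-in : ∀ {n} → Closed n → ∀ k {x} → InRange n x → InRange n (walk k x)
  walk-in closed zero x∈ = x∈
  walk-in closed (suc k) x∈ = step-in closed (walk-in closed k x∈)

  walk-periodic : ∀ {p q x} → p < q → walk p x ≡ walk q x →
                  ∀ k → ∃ λ s → s < q × walk k x ≡ walk s x
  walk-periodic p<q loop zero = 0 , ≤-<-trans z≤n p<q , refl
  walk-periodic {p} {q} {x} p<q loop (suc k) with walk-periodic p<q loop k
  ... | s , s<q , k≈s with m≤n⇒m<n∨m≡n s<q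
  ...   | inj₁ s+1<q = suc s , s+1<q , cong step k≈s
  ...   | inj₂ refl = p , p<q , trans (cong step k≈s) (sym loop)

  halts-within : ∀ {n x} → Closed n → InRange n x → Halts x → HaltsIn n x
  halts-within {n} {x} closed x∈ (k , halt)
    with p , q , p<q , same-slot ← pigeonhole (n<1+n n) (λ t → slot (walk-in closed (toℕ t) x∈))
    with s , s<q , k≈s ← walk-periodic p<q
           (slot-injective (walk-in closed (toℕ p) x∈) (walk-in closed (toℕ q) x∈) same-slot) k
    = haltsIn-mono {s} {n} {x} (≤⇒≤′ (<⇒≤pred (<-trans s<q (toℕ<n q))))
                   (subst (HaltsIn 0) k≈s halt)

g≡g0∘walk : ∀ {A n} (T : Fin n → A) P k x → g T P k x ≡ g0 T P (Orbit.walk (g0 T P) k x)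
g≡g0∘walk T P zero x = refl
g≡g0∘walk T P (suc k) x with g T P k x | g≡g0∘walk T P k x
... | inj₁ a | eq = trans eq (cong (g0 T P) (sym (Orbit.step-char (g0 T P) (sym eq))))
... | inj₂ y | eq = cong (g0 T P) (sym (Orbit.step-ptr (g0 T P) (sym eq)))

module _ {A : Set} {n : ℕ} (T : Fin n → A) where

  g0-from-++ˡ : ∀ s P Q x → s ≤ x → x < s + len P → g0-from T s (P ++ Q) x ≡ g0-from T s P x
  g0-from-++ˡ s [] Q x s≤x x<s =
    ⊥-elim (≤⇒≯ s≤x (subst (x <_) (+-identityʳ s) x<s))
  g0-from-++ˡ s (chr c ∷ P) Q x s≤x x<end with x <? suc s
  ... | yes _ = refl
  ... | no x≮ = g0-from-++ˡ (suc s) P Q x (≮⇒≥ x≮) (subst (x <_) (+-suc s (len P)) x<end)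
  g0-from-++ˡ s (tgt t ℓ ∷ P) Q x s≤x x<end with x <? s + ℓ
  ... | yes _ = refl
  ... | no x≮ = g0-from-++ˡ (s + ℓ) P Q x (≮⇒≥ x≮) (subst (x <_) (sym (+-assoc s ℓ (len P))) x<end)

  g0-from-++ʳ : ∀ s P Q x → s + len P ≤ x → g0-from T s (P ++ Q) x ≡ g0-from T (s + len P) Q x
  g0-from-++ʳ s [] Q x _ = cong (λ s′ → g0-from T s′ Q x) (sym (+-identityʳ s))
  g0-from-++ʳ s (chr c ∷ P) Q x end≤x with x <? suc s
  ... | yes x<s+1 =
    ⊥-elim (<⇒≱ x<s+1 (≤-trans (s≤s (m≤m+n s (len P))) (subst (_≤ x) (+-suc s (len P)) end≤x)))
  ... | no _ = trans (g0-from-++ʳ (suc s) P Q x (subst (_≤ x) (+-suc s (len P)) end≤x))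
                     (cong (λ s′ → g0-from T s′ Q x) (sym (+-suc s (len P))))
  g0-from-++ʳ s (tgt t ℓ ∷ P) Q x end≤x with x <? s + ℓ
  ... | yes x<s+ℓ =
    ⊥-elim (<⇒≱ x<s+ℓ (≤-trans (m≤m+n (s + ℓ) (len P)) (subst (_≤ x) (sym (+-assoc s ℓ (len P))) end≤x)))
  ... | no _ = trans (g0-from-++ʳ (s + ℓ) P Q x (subst (_≤ x) (sym (+-assoc s ℓ (len P))) end≤x))
                     (cong (λ s′ → g0-from T s′ Q x) (+-assoc s ℓ (len P)))

  g0-from-[]-char : ∀ s {x} → InRange n x → ∃ λ a → g0-from T s [] x ≡ inj₁ a
  g0-from-[]-char s {suc x} (_ , x<n) with x <? n
  ... | yes _ = _ , refl
  ... | no x≮n = ⊥-elim (x≮n x<n)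

  g0-from-tgt-inside : ∀ s t ℓ Q {x} → x < s + ℓ → g0-from T s (tgt t ℓ ∷ Q) x ≡ inj₂ (t + (x ∸ s))
  g0-from-tgt-inside s t ℓ Q {x} x<s+ℓ with x <? s + ℓ
  ... | yes _ = refl
  ... | no x≮ = ⊥-elim (x≮ x<s+ℓ)

  g0-from-tgt-outside : ∀ s t ℓ Q {x} → s + ℓ ≤ x → g0-from T s (tgt t ℓ ∷ Q) x ≡ g0-from T (s + ℓ) Q x
  g0-from-tgt-outside s t ℓ Q {x} s+ℓ≤x with x <? s + ℓ
  ... | yes x<s+ℓ = ⊥-elim (<⇒≱ x<s+ℓ s+ℓ≤x)
  ... | no _ = refl

  PBP-from-closed : ∀ s P {x y} → PBP-from T s P → InRange n x → s ≤ x →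
                    g0-from T s P x ≡ inj₂ y → InRange n y
  PBP-from-closed s [] _ x∈ _ ptr with trans (sym (proj₂ (g0-from-[]-char s x∈))) ptr
  ... | ()
  PBP-from-closed s (chr c ∷ P) {x} (_ , pbp) x∈ s≤x ptr with x <? suc s
  ... | no x≮ = PBP-from-closed (suc s) P pbp x∈ (≮⇒≥ x≮) ptr
  PBP-from-closed s (tgt t ℓ ∷ P) {x} (_ , 1≤t , _ , t+ℓ∸1≤n , _ , _ , pbp) x∈ s≤x ptr with x <? s + ℓ
  ... | no x≮ = PBP-from-closed (s + ℓ) P pbp x∈ (≮⇒≥ x≮) ptr
  PBP-from-closed s (tgt t ℓ ∷ P) {x} (_ , 1≤t , _ , t+ℓ∸1≤n , _ , _ , _) _ s≤x refl | yes x<s+ℓ =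
    ≤-trans 1≤t (m≤m+n t (x ∸ s)) , block-≤ (offset< ℓ s≤x x<s+ℓ) t+ℓ∸1≤n

  PBP-from-++ : ∀ s P Q → PBP-from T s P → PBP-from T (s + len P) Q → PBP-from T s (P ++ Q)
  PBP-from-++ s [] Q _ q = subst (λ s′ → PBP-from T s′ Q) (+-identityʳ s) q
  PBP-from-++ s (chr c ∷ P) Q (at≡c , p) q =
    at≡c , PBP-from-++ (suc s) P Q p (subst (λ s′ → PBP-from T s′ Q) (+-suc s (len P)) q)
  PBP-from-++ s (tgt t ℓ ∷ P) Q (1≤ℓ , 1≤t , t≢s , t-end , s-end , same , p) q =
    1≤ℓ , 1≤t , t≢s , t-end , s-end , same ,
    PBP-from-++ (s + ℓ) P Q p (subst (λ s′ → PBP-from T s′ Q) (sym (+-assoc s ℓ (len P))) q)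

module Extension {A : Set} {n : ℕ} (T : Fin n → A) (P : List (Phrase A)) (pbp : IsPBP T P)
                 (j ℓ : ℕ) (i<j : suc (len P) < j) (j+ℓ∸1≤n : j + ℓ ∸ 1 ≤ n) where

  i : ℕ
  i = suc (len P)

  P′ : List (Phrase A)
  P′ = P ++ [ tgt j ℓ ]

  module O = Orbit (g0 T P)
  module O′ = Orbit (g0 T P′)

  g0-extend-below : ∀ {x} → 1 ≤ x → x < i → g0 T P′ x ≡ g0 T P x
  g0-extend-below {x} 1≤x x<i = g0-from-++ˡ T 1 P [ tgt j ℓ ] x 1≤x x<i

  g0-extend-block : ∀ {x} → i ≤ x → x < i + ℓ → g0 T P′ x ≡ inj₂ (j + (x ∸ i))
  g0-extend-block {x} i≤x x<i+ℓ =
    trans (g0-from-++ʳ T 1 P [ tgt j ℓ ] x i≤x) (g0-from-tgt-inside T i j ℓ [] x<i+ℓ)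

  g0-extend-beyond : ∀ {x} → i + ℓ ≤ x → x ≤ n → ∃ λ a → g0 T P′ x ≡ inj₁ a
  g0-extend-beyond {x} i+ℓ≤x x≤n =
    let i≤x = ≤-trans (m≤m+n i ℓ) i+ℓ≤x
        a , char = g0-from-[]-char T (i + ℓ) (≤-trans (s≤s z≤n) i≤x , x≤n)
    in a , trans (trans (g0-from-++ʳ T 1 P [ tgt j ℓ ] x i≤x) (g0-from-tgt-outside T i j ℓ [] i+ℓ≤x)) char

  block-target-in-range : ∀ {x} → i ≤ x → x < i + ℓ → InRange n (j + (x ∸ i))
  block-target-in-range {x} i≤x x<i+ℓ =
    ≤-trans (s≤s z≤n) (≤-trans (<⇒≤ i<j) (m≤m+n j (x ∸ i))) , block-≤ (offset< ℓ i≤x x<i+ℓ) j+ℓ∸1≤n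

  block-target-forward : ∀ {x} → i ≤ x → x < j + (x ∸ i)
  block-target-forward {x} i≤x = subst (_< j + (x ∸ i)) (m+[n∸m]≡n i≤x) (+-monoˡ-< (x ∸ i) i<j)

  closed : O.Closed n
  closed x y x∈ = PBP-from-closed T 1 P pbp x∈ (proj₁ x∈)

  closed′ : O′.Closed n
  closed′ x y x∈@(1≤x , x≤n) ptr with x <? i
  ... | yes x<i = closed x y x∈ (trans (sym (g0-extend-below 1≤x x<i)) ptr)
  ... | no x≮i with x <? i + ℓ
  ...   | yes x<i+ℓ =
    subst (InRange n) (inj₂-injective (trans (sym (g0-extend-block (≮⇒≥ x≮i) x<i+ℓ)) ptr))
          (block-target-in-range (≮⇒≥ x≮i) x<i+ℓ)
  ...   | no x≮i+ℓ with g0-extend-beyond (≮⇒≥ x≮i+ℓ) x≤n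
  ...     | a , char with trans (sym char) ptr
  ...       | ()

  halts-after-prefix : ∀ y → Acc (_<_ on (n ∸_)) y → i ≤ y → y ≤ n → O′.Halts y
  halts-after-prefix y (acc rec) i≤y y≤n with y <? i + ℓ
  ... | no y≮i+ℓ = 0 , g0-extend-beyond (≮⇒≥ y≮i+ℓ) y≤n
  ... | yes y<i+ℓ =
    O′.halts-ptr (g0-extend-block i≤y y<i+ℓ)
      (halts-after-prefix y′ (rec (∸-monoʳ-< y<y′ y′≤n)) (≤-trans i≤y (<⇒≤ y<y′)) y′≤n)
    where
      y′ : ℕ
      y′ = j + (y ∸ i)
      y<y′ : y < y′
      y<y′ = block-target-forward i≤y
      y′≤n : y′ ≤ n
      y′≤n = proj₂ (block-target-in-range i≤y y<i+ℓ)

  halts-extend : ∀ k x → InRange n x → O.HaltsIn k x → O′.Halts x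
  halts-extend k x x∈@(1≤x , x≤n) halt with x <? i
  ... | no x≮i = halts-after-prefix x (On.wellFounded (n ∸_) <-wellFounded x) (≮⇒≥ x≮i) x≤n
  ... | yes x<i with g0 T P x in eq
  ...   | inj₁ a = 0 , a , trans (g0-extend-below 1≤x x<i) eq
  halts-extend zero x _ (a , char) | yes _ | inj₂ y with trans (sym eq) char
  ... | ()
  halts-extend (suc k) x x∈@(1≤x , _) halt | yes x<i | inj₂ y =
    O′.halts-ptr (trans (g0-extend-below 1≤x x<i) eq)
      (halts-extend k y (closed x y x∈ eq) (O.haltsIn-ptr {k} eq halt))

lemma4 : {A : Set} (_≺_ : A → A → Set) → IsStrictTotalOrder _≡_ _≺_ →
    (n : ℕ) (T : Fin n → A) (P : List (Phrase A)) →
    IsPBP T P → Valid T P →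
    (j ℓ : ℕ) → suc (len P) < j → 1 ≤ ℓ → j + ℓ ∸ 1 ≤ n →
    SubEq T (suc (len P)) j ℓ →
    IsPBP T (P ++ [ tgt j ℓ ]) × Valid T (P ++ [ tgt j ℓ ])
lemma4 _ _ n T P pbp valid j ℓ i<j 1≤ℓ j+ℓ∸1≤n same = pbp′ , valid′
  where
    open Extension T P pbp j ℓ i<j j+ℓ∸1≤n

    i+ℓ∸1≤n : i + ℓ ∸ 1 ≤ n
    i+ℓ∸1≤n = ≤-trans (∸-monoˡ-≤ 1 (+-monoˡ-≤ ℓ (<⇒≤ i<j))) j+ℓ∸1≤n

    pbp′ : IsPBP T P′
    pbp′ = PBP-from-++ T 1 P [ tgt j ℓ ] pbp
             (1≤ℓ , ≤-trans (s≤s z≤n) (<⇒≤ i<j) , (λ j≡i → <-irrefl (sym j≡i) i<j) ,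
              j+ℓ∸1≤n , i+ℓ∸1≤n , same , ∸1≤⇒≤suc i+ℓ∸1≤n)

    valid′ : Valid T P′
    valid′ x 1≤x x≤n =
      let a , halt = valid x 1≤x x≤n
          halt′ = O′.halts-within closed′ (1≤x , x≤n)
                    (halts-extend n x (1≤x , x≤n) (a , trans (sym (g≡g0∘walk T P n x)) halt))
      in proj₁ halt′ , trans (g≡g0∘walk T P′ n x) (proj₂ halt′)
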